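{- Let $M_1=(X,\mathcal{I}_1)$ be a matroid and $M_2,\ldots,M_k$ partition matroids on $X$; let $\alpha=\chi(M_1)$ and $B=\sum_{i=2}^k(\chi(M_i)-1)$. Let $c$ be a feasible coloring of some elements of $M=\bigcap_{i=1}^kM_i$ with colors in $[\alpha+B]$ such that the set $U$ of uncolored elements is nonempty, and let $G=(V,A)$ be the Edmonds digraph of $M_1$ with respect to $c$ (with $\alpha+B$ colors). Let $Y\subseteq V$ with $[\alpha+B]\cap Y=\emptyset$ and $U\subseteq Y$, and let $\overline{Y}=V\setminus Y$. Then there is a set of arcs $A'\subseteq\delta(\overline{Y},Y)$ with $|A'|>B\cdot|Y|$ such that no two arcs of $A'$ have both the same target vertex and source vertices of the same color.
   Context: Coloring $c:X\to\{0,1,\ldots,\alpha+B\}$, $c(x)=0$ meaning uncolored; color classes $S_j=\{x:c(x)=j\}$; feasible means each $S_j$ is independent in every $M_i$. Edmonds digraph: $V=[\alpha+B]\cup X$ (color vertices disjoint from $X$), $A=\bigcup_jA_j$, where $A_j$ contains $(j,x)$ for every $x\notin S_j$ with $S_j\cup\{x\}\in\mathcal{I}_1$, and, for each $x\notin S_j$ with $S_j\cup\{x\}\notin\mathcal{I}_1$, the arc $(y,x)$ for each $y\in S_j$ with $S_j-\{y\}\cup\{x\}\in\mathcal{I}_1$. The color of a color vertex $j$ is $j$, the color of an element $x$ is $c(x)$. $\delta(\overline{Y},Y)=\{(x,y)\in A:x\in\overline{Y},y\in Y\}$. -}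

module Defs where

open import Data.Nat using (ℕ; _<_; _∸_; _*_)
open import Data.Fin using (Fin; zero; suc; _≟_)
open import Data.Fin.Subset using (Subset; _∈_; _∉_; _⊆_; _∪_; _-_; ⁅_⁆; ⊥; ∣_∣)
open import Data.Vec using (tabulate)
open import Data.List using (List; map; allFin)
open import Data.Nat.ListAction using (sum)
open import Data.Product using (Σ; _×_; ∃)
open import Data.Sum using (_⊎_; inj₁; inj₂)
open import Relation.Nullary using (¬_; Dec)
open import Relation.Nullary.Decidable using (⌊_⌋)
open import Relation.Binary.PropositionalEquality using (_≡_)

record Matroid (n : ℕ) : Set₁ where
  field
    Ind      : Subset n → Set
    Ind?     : (S : Subset n) → Dec (Ind S)
    Ind-⊥    : Ind ⊥
    Ind-⊆    : ∀ {S T} → S ⊆ T → Ind T → Ind S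
    Ind-exch : ∀ {S T} → Ind S → Ind T → ∣ S ∣ < ∣ T ∣ →
               ∃ λ x → x ∈ T × x ∉ S × Ind (S ∪ ⁅ x ⁆)
open Matroid public

classOf : ∀ {n k} → (Fin n → Fin k) → Fin k → Subset n
classOf f j = tabulate (λ x → ⌊ f x ≟ j ⌋)

Colorable : ∀ {n} → (Subset n → Set) → ℕ → Set
Colorable {n} Ind k = Σ (Fin n → Fin k) λ f → ∀ j → Ind (classOf f j)

IsChromaticNumber : ∀ {n} → (Subset n → Set) → ℕ → Set
IsChromaticNumber Ind a = Colorable Ind a × (∀ k → k < a → ¬ Colorable Ind k)

-- Partition matroid given by a block labelling p : X → ℕ
-- (independent = at most one element from each block).
PartInd : ∀ {n} → (Fin n → ℕ) → Subset n → Set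
PartInd p S = ∀ x y → x ∈ S → y ∈ S → p x ≡ p y → x ≡ y

-- Partial colorings c : X → {0,…,K}, 0 = uncolored, value suc j = color j (j : Fin K).
-- Color class S_j.
S : ∀ {n K} → (Fin n → Fin (ℕ.suc K)) → Fin K → Subset n
S c j = tabulate (λ x → ⌊ c x ≟ suc j ⌋)

-- Vertices of the Edmonds digraph: color vertices ⊎ elements of X.
Vertex : ℕ → ℕ → Set
Vertex K n = Fin K ⊎ Fin n

colorV : ∀ {n K} → (Fin n → Fin (ℕ.suc K)) → Vertex K n → Fin (ℕ.suc K)
colorV c (inj₁ j) = suc j
colorV c (inj₂ x) = c x

Arc : ∀ {n K} → Matroid n → (Fin n → Fin (ℕ.suc K)) → Vertex K n → Vertex K n → Set
Arc M c (inj₁ j) (inj₂ x) = x ∉ S c j × Ind M (S c j ∪ ⁅ x ⁆)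
Arc M c (inj₂ y) (inj₂ x) =
  Σ _ λ j → x ∉ S c j × ¬ Ind M (S c j ∪ ⁅ x ⁆) × y ∈ S c j × Ind M ((S c j - y) ∪ ⁅ x ⁆)
Arc M c (inj₁ j) (inj₁ j′) = Data.Empty.⊥
  where import Data.Empty
Arc M c (inj₂ y) (inj₁ j) = Data.Empty.⊥
  where import Data.Empty

∑ : ∀ {r} → (Fin r → ℕ) → ℕ
∑ {r} f = sum (map f (allFin r))

{-# OPTIONS --safe #-}
-- Fix a colour j and let I j = S_j ∩ Y. Every y ∈ Y either receives an arc of colour j from
-- outside Y, or is spanned by I j: it lies in I j, or the fundamental circuit of y in S_j lies
-- inside I j ∪ {y}. An independent set of spanned elements has at most ∣I j∣ elements, so,
-- covering X by α independent sets, at most α ∣I j∣ elements of Y are spanned. The uncoloured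
-- element lies in Y, hence Σ_j ∣I j∣ ≤ ∣Y∣ - 1, and one arc per (colour, target) pair gives at
-- least (α + B) ∣Y∣ - α (∣Y∣ - 1) > B ∣Y∣ arcs, as α ≥ 1.
module Submission where

open import Defs
open import Data.Nat using (ℕ; zero; suc; _+_; _*_; _∸_; _<_; _≤_; _≤?_; z≤n; s≤s; >-nonZero⁻¹)
open import Data.Nat.Properties
  using (+-*-semiring; ≤-trans; ≤-reflexive; ≤-<-trans; ≰⇒>; <⇒≱; +-comm; +-assoc; +-suc; +-monoʳ-≤; +-mono-≤; n≤1+n;
         +-cancelʳ-≤; *-suc; <-≤-trans; m<m+n; *-monoʳ-≤; *-distribʳ-+; m≤m+n; m<n+m; module ≤-Reasoning)
open import Data.Bool using (Bool; true; false; _∧_)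
open import Data.Fin using (Fin; zero; suc)
open import Data.Fin.Properties using (_≟_; any?; nonZeroIndex) renaming (suc-injective to Fin-suc-injective)
open import Data.Fin.Subset using (Subset; _∈_; _∉_; _⊆_; _∪_; _∩_; _-_; ⁅_⁆; ∣_∣; inside; outside)
open import Data.Fin.Subset.Properties
  using (_∈?_; x∈⁅x⁆; x∈⁅y⁆⇒x≡y; ∣⁅x⁆∣≡1; x∈p∪q⁻; x∈p∪q⁺; p⊆p∪q; x∈p∩q⁺; x∈p∩q⁻; p∩q⊆q;
         x∈p∧x≢y⇒x∈p-y; x∈p⇒∣p-x∣<∣p∣; p⊂q⇒∣p∣<∣q∣)
open import Data.Vec using ([]; _∷_; tabulate; lookup)
open import Data.Vec.Properties using (lookup∘tabulate; []=⇒lookup; lookup⇒[]=)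
open import Data.List using (List; []; _∷_; _++_; length; mapMaybe; cartesianProduct; allFin; map)
import Data.List as List
open import Data.List.Properties using (length-++; mapMaybe-++; mapMaybe-map)
open import Data.List.Membership.Propositional using () renaming (_∈_ to _∈ₗ_)
open import Data.List.Relation.Unary.Any using (here; there)
import Data.List.Relation.Unary.All as All
open import Data.List.Relation.Unary.AllPairs using ([]; _∷_)
open import Data.List.Relation.Unary.Unique.Propositional using (Unique)
open import Data.List.Relation.Unary.Unique.Propositional.Properties using (cartesianProduct⁺; allFin⁺)
open import Data.Maybe using (Maybe; just; nothing; is-just)
open import Data.Maybe.Properties using (just-injective)
open import Data.Product using (Σ; _×_; ∃; _,_; proj₁; proj₂; map₁; map₂)
open import Data.Sum using (_⊎_; inj₁; inj₂)
import Data.Sum as Sum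
open import Data.Empty using (⊥-elim)
open import Function using (_∘_; id)
open import Relation.Nullary using (¬_; yes; no; ¬?)
open import Relation.Nullary.Decidable using (⌊_⌋; _×-dec_; ⌊⌋-map′; dec-true; isYes≗does)
open import Relation.Binary.PropositionalEquality using (_≡_; _≢_; refl; sym; trans; cong; cong₂; subst; module ≡-Reasoning)
open import Algebra.Properties.Semiring.Sum +-*-semiring using (sum-syntax; ∑-distrib-+; sum-cong-≗; sum-replicate-zero; *-distribˡ-sum)

𝟙 : Bool → ℕ
𝟙 true  = 1
𝟙 false = 0

∑-const : ∀ m k → ∑[ i < m ] k ≡ m * k
∑-const zero    k = refl
∑-const (suc m) k = cong (k +_) (∑-const m k)

∑-mono-≤ : ∀ {m} {f g : Fin m → ℕ} → (∀ i → f i ≤ g i) → ∑[ i < m ] f i ≤ ∑[ i < m ] g i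
∑-mono-≤ {zero}  f≤g = z≤n
∑-mono-≤ {suc m} f≤g = +-mono-≤ (f≤g zero) (∑-mono-≤ (f≤g ∘ suc))

∣b∷p∣≡𝟙b+∣p∣ : ∀ {n} b (p : Subset n) → ∣ b ∷ p ∣ ≡ 𝟙 b + ∣ p ∣
∣b∷p∣≡𝟙b+∣p∣ true  p = refl
∣b∷p∣≡𝟙b+∣p∣ false p = refl

∣p∣≡∑𝟙 : ∀ {n} (p : Subset n) → ∣ p ∣ ≡ ∑[ x < n ] 𝟙 (lookup p x)
∣p∣≡∑𝟙 []      = refl
∣p∣≡∑𝟙 (b ∷ p) = trans (∣b∷p∣≡𝟙b+∣p∣ b p) (cong (𝟙 b +_) (∣p∣≡∑𝟙 p))

∣tabulate∣≡∑𝟙 : ∀ {n} (b : Fin n → Bool) → ∣ tabulate b ∣ ≡ ∑[ x < n ] 𝟙 (b x)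
∣tabulate∣≡∑𝟙 b = trans (∣p∣≡∑𝟙 (tabulate b)) (sum-cong-≗ (cong 𝟙 ∘ lookup∘tabulate b))

∑𝟙⌊a≟k⌋≡1 : ∀ {m} (a : Fin m) → ∑[ k < m ] 𝟙 ⌊ a ≟ k ⌋ ≡ 1
∑𝟙⌊a≟k⌋≡1 {suc m} zero    = cong suc (sum-replicate-zero m)
∑𝟙⌊a≟k⌋≡1 {suc m} (suc a) = trans (sum-cong-≗ (λ k → cong 𝟙 (⌊⌋-map′ _ _ (a ≟ k)))) (∑𝟙⌊a≟k⌋≡1 a)

∣p∣≡∑∣p∩classOf∣ : ∀ {n m} (p : Subset n) (f : Fin n → Fin m) → ∣ p ∣ ≡ ∑[ k < m ] ∣ p ∩ classOf f k ∣
∣p∣≡∑∣p∩classOf∣ {m = m} []      f = sym (sum-replicate-zero m)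
∣p∣≡∑∣p∩classOf∣ {m = m} (b ∷ p) f = begin
  ∣ b ∷ p ∣
    ≡⟨ ∣b∷p∣≡𝟙b+∣p∣ b p ⟩
  𝟙 b + ∣ p ∣
    ≡⟨ cong₂ _+_ (sym (∑𝟙[b∧⌊a≟k⌋]≡𝟙b b)) (∣p∣≡∑∣p∩classOf∣ p (f ∘ suc)) ⟩
  ∑[ k < m ] 𝟙 (b ∧ ⌊ f zero ≟ k ⌋) + ∑[ k < m ] ∣ p ∩ classOf (f ∘ suc) k ∣
    ≡⟨ sym (∑-distrib-+ (λ k → 𝟙 (b ∧ ⌊ f zero ≟ k ⌋)) (λ k → ∣ p ∩ classOf (f ∘ suc) k ∣)) ⟩
  ∑[ k < m ] (𝟙 (b ∧ ⌊ f zero ≟ k ⌋) + ∣ p ∩ classOf (f ∘ suc) k ∣)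
    ≡⟨ sum-cong-≗ (λ k → sym (∣b∷p∣≡𝟙b+∣p∣ (b ∧ ⌊ f zero ≟ k ⌋) (p ∩ classOf (f ∘ suc) k))) ⟩
  ∑[ k < m ] ∣ (b ∷ p) ∩ classOf f k ∣
    ∎
  where
  open ≡-Reasoning
  ∑𝟙[b∧⌊a≟k⌋]≡𝟙b : ∀ b → ∑[ k < m ] 𝟙 (b ∧ ⌊ f zero ≟ k ⌋) ≡ 𝟙 b
  ∑𝟙[b∧⌊a≟k⌋]≡𝟙b true  = ∑𝟙⌊a≟k⌋≡1 (f zero)
  ∑𝟙[b∧⌊a≟k⌋]≡𝟙b false = sum-replicate-zero m

∣p∪q∣≤∣p∣+∣q∣ : ∀ {n} (p q : Subset n) → ∣ p ∪ q ∣ ≤ ∣ p ∣ + ∣ q ∣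
∣p∪q∣≤∣p∣+∣q∣ []            []            = z≤n
∣p∪q∣≤∣p∣+∣q∣ (outside ∷ p) (outside ∷ q) = ∣p∪q∣≤∣p∣+∣q∣ p q
∣p∪q∣≤∣p∣+∣q∣ (inside  ∷ p) (outside ∷ q) = s≤s (∣p∪q∣≤∣p∣+∣q∣ p q)
∣p∪q∣≤∣p∣+∣q∣ (outside ∷ p) (inside  ∷ q) =
  subst (suc ∣ p ∪ q ∣ ≤_) (sym (+-suc ∣ p ∣ ∣ q ∣)) (s≤s (∣p∪q∣≤∣p∣+∣q∣ p q))
∣p∪q∣≤∣p∣+∣q∣ (inside  ∷ p) (inside  ∷ q) =
  s≤s (≤-trans (∣p∪q∣≤∣p∣+∣q∣ p q) (+-monoʳ-≤ ∣ p ∣ (n≤1+n ∣ q ∣)))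

∣p-x∪⁅y⁆∣≤∣p∣ : ∀ {n} {p : Subset n} {x} y → x ∈ p → ∣ (p - x) ∪ ⁅ y ⁆ ∣ ≤ ∣ p ∣
∣p-x∪⁅y⁆∣≤∣p∣ {p = p} {x} y x∈p = begin
  ∣ (p - x) ∪ ⁅ y ⁆ ∣     ≤⟨ ∣p∪q∣≤∣p∣+∣q∣ (p - x) ⁅ y ⁆ ⟩
  ∣ p - x ∣ + ∣ ⁅ y ⁆ ∣   ≡⟨ cong (∣ p - x ∣ +_) (∣⁅x⁆∣≡1 y) ⟩
  ∣ p - x ∣ + 1           ≡⟨ +-comm ∣ p - x ∣ 1 ⟩
  suc ∣ p - x ∣           ≤⟨ x∈p⇒∣p-x∣<∣p∣ x∈p ⟩
  ∣ p ∣                   ∎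
  where open ≤-Reasoning

⊆⊎∃∈∉ : ∀ {n} (p q : Subset n) → p ⊆ q ⊎ ∃ λ x → x ∈ p × x ∉ q
⊆⊎∃∈∉ p q with any? (λ x → x ∈? p ×-dec ¬? (x ∈? q))
... | yes witness = inj₂ witness
... | no none     = inj₁ p⊆q
  where
  p⊆q : p ⊆ q
  p⊆q {x} x∈p with x ∈? q
  ... | yes x∈q = x∈q
  ... | no  x∉q = ⊥-elim (none (x , x∈p , x∉q))

p⊆q∧∣q∣≤∣p∣⇒q⊆p : ∀ {n} {p q : Subset n} → p ⊆ q → ∣ q ∣ ≤ ∣ p ∣ → q ⊆ p
p⊆q∧∣q∣≤∣p∣⇒q⊆p {p = p} {q} p⊆q ∣q∣≤∣p∣ with ⊆⊎∃∈∉ q p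
... | inj₁ q⊆p              = q⊆p
... | inj₂ (x , x∈q , x∉p) = ⊥-elim (<⇒≱ (p⊂q⇒∣p∣<∣q∣ (p⊆q , x , x∈q , x∉p)) ∣q∣≤∣p∣)

x∈p⇒0<∣p∣ : ∀ {n} {p : Subset n} {x} → x ∈ p → 0 < ∣ p ∣
x∈p⇒0<∣p∣ x∈p = ≤-<-trans z≤n (x∈p⇒∣p-x∣<∣p∣ x∈p)

x∉p⇒lookup≡outside : ∀ {n} {p : Subset n} {x} → x ∉ p → lookup p x ≡ outside
x∉p⇒lookup≡outside {p = p} {x} x∉p with lookup p x in eq
... | inside  = ⊥-elim (x∉p (lookup⇒[]= x p eq))
... | outside = refl

∈tabulate⁻ : ∀ {n} (b : Fin n → Bool) {x} → x ∈ tabulate b → b x ≡ true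
∈tabulate⁻ b {x} x∈ = trans (sym (lookup∘tabulate b x)) ([]=⇒lookup x∈)

∈tabulate⁺ : ∀ {n} (b : Fin n → Bool) {x} → b x ≡ true → x ∈ tabulate b
∈tabulate⁺ b {x} bx = lookup⇒[]= x (tabulate b) (trans (lookup∘tabulate b x) bx)

module _ {n : ℕ} (M : Matroid n) where

  augment-by : ∀ m {K S T} → ∣ S ∣ ≤ m + ∣ K ∣ → Ind M K → Ind M S → K ⊆ T → S ⊆ T →
               ∃ λ K′ → K ⊆ K′ × K′ ⊆ T × Ind M K′ × ∣ S ∣ ≤ ∣ K′ ∣
  augment-by zero    {K} ∣S∣≤∣K∣ indK indS K⊆T S⊆T = K , id , K⊆T , indK , ∣S∣≤∣K∣
  augment-by (suc m) {K} {S} {T} ∣S∣≤1+m+∣K∣ indK indS K⊆T S⊆T with ∣ S ∣ ≤? ∣ K ∣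
  ... | yes ∣S∣≤∣K∣ = K , id , K⊆T , indK , ∣S∣≤∣K∣
  ... | no  ∣S∣≰∣K∣ with Ind-exch M indK indS (≰⇒> ∣S∣≰∣K∣)
  ...   | w , w∈S , w∉K , indK+w with augment-by m ∣S∣≤m+∣K+w∣ indK+w indS K+w⊆T S⊆T
    where
    K+w⊆T : K ∪ ⁅ w ⁆ ⊆ T
    K+w⊆T v∈ with x∈p∪q⁻ K ⁅ w ⁆ v∈
    ... | inj₁ v∈K = K⊆T v∈K
    ... | inj₂ v∈w = S⊆T (subst (_∈ S) (sym (x∈⁅y⁆⇒x≡y w v∈w)) w∈S)
    ∣S∣≤m+∣K+w∣ : ∣ S ∣ ≤ m + ∣ K ∪ ⁅ w ⁆ ∣
    ∣S∣≤m+∣K+w∣ = begin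
      ∣ S ∣              ≤⟨ ∣S∣≤1+m+∣K∣ ⟩
      suc m + ∣ K ∣      ≡⟨ sym (+-suc m ∣ K ∣) ⟩
      m + suc ∣ K ∣      ≤⟨ +-monoʳ-≤ m (p⊂q⇒∣p∣<∣q∣ (p⊆p∪q ⁅ w ⁆ , w , x∈p∪q⁺ (inj₂ (x∈⁅x⁆ w)) , w∉K)) ⟩
      m + ∣ K ∪ ⁅ w ⁆ ∣  ∎
      where open ≤-Reasoning
  ...     | K′ , K+w⊆K′ , rest = K′ , K+w⊆K′ ∘ p⊆p∪q ⁅ w ⁆ , rest

  augment : ∀ {K S T} → Ind M K → Ind M S → K ⊆ T → S ⊆ T →
            ∃ λ K′ → K ⊆ K′ × K′ ⊆ T × Ind M K′ × ∣ S ∣ ≤ ∣ K′ ∣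
  augment {K} {S} = augment-by ∣ S ∣ (m≤m+n ∣ S ∣ ∣ K ∣)

  circuit-exchange : ∀ {S K y} → ¬ Ind M (S ∪ ⁅ y ⁆) →
                     Ind M K → K ⊆ S ∪ ⁅ y ⁆ → y ∈ K → ∣ S ∣ ≤ ∣ K ∣ →
                     ∃ λ z → z ∈ S × z ∉ K × Ind M ((S - z) ∪ ⁅ y ⁆)
  circuit-exchange {S} {K} {y} dep indK K⊆S+y y∈K ∣S∣≤∣K∣ with ⊆⊎∃∈∉ (S ∪ ⁅ y ⁆) K
  ... | inj₁ S+y⊆K             = ⊥-elim (dep (Ind-⊆ M S+y⊆K indK))
  ... | inj₂ (z , z∈S+y , z∉K) = z , z∈S , z∉K , Ind-⊆ M (p⊆q∧∣q∣≤∣p∣⇒q⊆p K⊆S-z+y ∣S-z+y∣≤∣K∣) indK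
    where
    z∈S : z ∈ S
    z∈S with x∈p∪q⁻ S ⁅ y ⁆ z∈S+y
    ... | inj₁ z∈S = z∈S
    ... | inj₂ z∈y = ⊥-elim (z∉K (subst (_∈ K) (sym (x∈⁅y⁆⇒x≡y y z∈y)) y∈K))
    K⊆S-z+y : K ⊆ (S - z) ∪ ⁅ y ⁆
    K⊆S-z+y {v} v∈K =
      x∈p∪q⁺ (Sum.map₁ (λ v∈S → x∈p∧x≢y⇒x∈p-y v∈S λ { refl → z∉K v∈K }) (x∈p∪q⁻ S ⁅ y ⁆ (K⊆S+y v∈K)))
    ∣S-z+y∣≤∣K∣ : ∣ (S - z) ∪ ⁅ y ⁆ ∣ ≤ ∣ K ∣
    ∣S-z+y∣≤∣K∣ = ≤-trans (∣p-x∪⁅y⁆∣≤∣p∣ y z∈S) ∣S∣≤∣K∣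

  -- The second alternative says that the fundamental circuit of y in S lies in I ∪ ⁅ y ⁆.
  SpannedVia : Subset n → Subset n → Fin n → Set
  SpannedVia S I y = y ∈ I ⊎ (¬ Ind M (S ∪ ⁅ y ⁆) × (∀ z → z ∈ S → Ind M ((S - z) ∪ ⁅ y ⁆) → z ∈ I))

  spanned⇒dependent : ∀ {S I y} → Ind M S → I ⊆ S → ¬ Ind M (S ∪ ⁅ y ⁆) →
                      (∀ z → z ∈ S → Ind M ((S - z) ∪ ⁅ y ⁆) → z ∈ I) → ¬ Ind M (I ∪ ⁅ y ⁆)
  spanned⇒dependent {S} {I} {y} indS I⊆S dep exchanges⊆I indI+y
    with augment indI+y indS (x∈p∪q⁺ ∘ Sum.map₁ I⊆S ∘ x∈p∪q⁻ I ⁅ y ⁆) (p⊆p∪q ⁅ y ⁆)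
  ... | K , I+y⊆K , K⊆S+y , indK , ∣S∣≤∣K∣
    with circuit-exchange dep indK K⊆S+y (I+y⊆K (x∈p∪q⁺ (inj₂ (x∈⁅x⁆ y)))) ∣S∣≤∣K∣
  ... | z , z∈S , z∉K , indS-z+y = z∉K (I+y⊆K (p⊆p∪q ⁅ y ⁆ (exchanges⊆I z z∈S indS-z+y)))

  spanned⇒∣J∣≤∣I∣ : ∀ {S I J} → Ind M S → I ⊆ S → Ind M J →
                    (∀ {y} → y ∈ J → SpannedVia S I y) → ∣ J ∣ ≤ ∣ I ∣
  spanned⇒∣J∣≤∣I∣ {S} {I} {J} indS I⊆S indJ spanned with ∣ J ∣ ≤? ∣ I ∣
  ... | yes ∣J∣≤∣I∣ = ∣J∣≤∣I∣
  ... | no  ∣J∣≰∣I∣ with Ind-exch M (Ind-⊆ M I⊆S indS) indJ (≰⇒> ∣J∣≰∣I∣)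
  ...   | y , y∈J , y∉I , indI+y with spanned y∈J
  ...     | inj₁ y∈I                 = ⊥-elim (y∉I y∈I)
  ...     | inj₂ (dep , exchanges⊆I) = ⊥-elim (spanned⇒dependent indS I⊆S dep exchanges⊆I indI+y)

module _ {A B : Set} (f : A → Maybe B) where

  ∈-mapMaybe⁻ : ∀ xs {b} → b ∈ₗ mapMaybe f xs → ∃ λ x → x ∈ₗ xs × f x ≡ just b
  ∈-mapMaybe⁻ (x ∷ xs) b∈ with f x in fx≡
  ∈-mapMaybe⁻ (x ∷ xs) (here refl) | just _  = x , here refl , fx≡
  ∈-mapMaybe⁻ (x ∷ xs) (there b∈)  | just _  = map₂ (map₁ there) (∈-mapMaybe⁻ xs b∈)
  ∈-mapMaybe⁻ (x ∷ xs) b∈          | nothing = map₂ (map₁ there) (∈-mapMaybe⁻ xs b∈)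

  mapMaybe⁺-Unique : (∀ {x y b} → f x ≡ just b → f y ≡ just b → x ≡ y) →
                     ∀ {xs} → Unique xs → Unique (mapMaybe f xs)
  mapMaybe⁺-Unique f-injective {[]}     []             = []
  mapMaybe⁺-Unique f-injective {x ∷ xs} (x∉xs ∷ uniq) with f x in fx≡
  ... | nothing = mapMaybe⁺-Unique f-injective uniq
  ... | just b  = All.tabulate b∉ ∷ mapMaybe⁺-Unique f-injective uniq
    where
    b∉ : ∀ {b′} → b′ ∈ₗ mapMaybe f xs → b ≢ b′
    b∉ b′∈ refl with ∈-mapMaybe⁻ xs b′∈
    ... | y , y∈xs , fy≡ = All.lookup x∉xs y∈xs (f-injective fx≡ fy≡)

  length-mapMaybe-tabulate : ∀ {m} (g : Fin m → A) → length (mapMaybe f (List.tabulate g)) ≡ ∑[ i < m ] 𝟙 (is-just (f (g i)))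
  length-mapMaybe-tabulate {zero}  g = refl
  length-mapMaybe-tabulate {suc m} g with f (g zero)
  ... | just _  = cong suc (length-mapMaybe-tabulate (g ∘ suc))
  ... | nothing = length-mapMaybe-tabulate (g ∘ suc)

length-mapMaybe-cartesianProduct : ∀ {A B C : Set} {m} (f : A × B → Maybe C) (g : Fin m → A) ys →
  length (mapMaybe f (cartesianProduct (List.tabulate g) ys)) ≡ ∑[ i < m ] length (mapMaybe (f ∘ (g i ,_)) ys)
length-mapMaybe-cartesianProduct {m = zero}  f g ys = refl
length-mapMaybe-cartesianProduct {A} {B} {m = suc m} f g ys = begin
  length (mapMaybe f (map (g zero ,_) ys ++ rest))
    ≡⟨ cong length (mapMaybe-++ f (map (g zero ,_) ys) rest) ⟩
  length (mapMaybe f (map (g zero ,_) ys) ++ mapMaybe f rest)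
    ≡⟨ length-++ (mapMaybe f (map (g zero ,_) ys)) ⟩
  length (mapMaybe f (map (g zero ,_) ys)) + length (mapMaybe f rest)
    ≡⟨ cong₂ _+_ (cong length (mapMaybe-map f (g zero ,_) ys)) (length-mapMaybe-cartesianProduct f (g ∘ suc) ys) ⟩
  length (mapMaybe (f ∘ (g zero ,_)) ys) + ∑[ i < m ] length (mapMaybe (f ∘ (g (suc i) ,_)) ys)
    ∎
  where
  open ≡-Reasoning
  rest : List (A × B)
  rest = cartesianProduct (List.tabulate (g ∘ suc)) ys

∈classOf⁻ : ∀ {n m} {f : Fin n → Fin m} {k x} → x ∈ classOf f k → f x ≡ k
∈classOf⁻ {f = f} {k} {x} x∈ with f x ≟ k | ∈tabulate⁻ (λ y → ⌊ f y ≟ k ⌋) x∈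
... | yes fx≡k | _ = fx≡k

∈classOf⁺ : ∀ {n m} {f : Fin n → Fin m} {k x} → f x ≡ k → x ∈ classOf f k
∈classOf⁺ {f = f} {k} {x} fx≡k =
  ∈tabulate⁺ (λ y → ⌊ f y ≟ k ⌋) (trans (isYes≗does (f x ≟ k)) (dec-true (f x ≟ k) fx≡k))

module EdmondsArcs {n K : ℕ} (M : Matroid n) (c : Fin n → Fin (suc K)) (Y : Subset n) where

  IncomingArc : Fin K → Fin n → Vertex K n → Set
  IncomingArc j y v = Arc M c v (inj₂ y) × colorV c v ≡ suc j × (∀ x → v ≡ inj₂ x → x ∉ Y)

  I : Fin K → Subset n
  I j = Y ∩ S c j

  data Status (j : Fin K) (y : Fin n) : Set where
    notInY  : y ∉ Y → Status j y
    entered : (v : Vertex K n) → IncomingArc j y v → y ∈ Y → Status j y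
    spanned : SpannedVia M (S c j) (I j) y → y ∈ Y → Status j y

  status : ∀ j y → Status j y
  status j y with y ∈? Y
  ... | no  y∉Y = notInY y∉Y
  ... | yes y∈Y with y ∈? S c j
  ...   | yes y∈S = spanned (inj₁ (x∈p∩q⁺ (y∈Y , y∈S))) y∈Y
  ...   | no  y∉S with Ind? M (S c j ∪ ⁅ y ⁆)
  ...     | yes indS+y = entered (inj₁ j) ((y∉S , indS+y) , refl , λ _ ()) y∈Y
  ...     | no  dep with any? (λ z → z ∈? S c j ×-dec ¬? (z ∈? Y) ×-dec Ind? M ((S c j - z) ∪ ⁅ y ⁆))
  ...       | yes (z , z∈S , z∉Y , indS-z+y) =
    entered (inj₂ z) ((j , y∉S , dep , z∈S , indS-z+y) , ∈classOf⁻ z∈S , λ { _ refl → z∉Y }) y∈Y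
  ...       | no  noExchangeOutsideY = spanned (inj₂ (dep , exchanges∈I)) y∈Y
    where
    exchanges∈I : ∀ z → z ∈ S c j → Ind M ((S c j - z) ∪ ⁅ y ⁆) → z ∈ I j
    exchanges∈I z z∈S indS-z+y with z ∈? Y
    ... | yes z∈Y = x∈p∩q⁺ (z∈Y , z∈S)
    ... | no  z∉Y = ⊥-elim (noExchangeOutsideY (z , z∈S , z∉Y , indS-z+y))

  arc : ∀ {j y} → Status j y → Maybe (Vertex K n × Fin n)
  arc {y = y} (entered v _ _) = just (v , y)
  arc         _               = nothing

  isSpanned : ∀ {j y} → Status j y → Bool
  isSpanned (spanned _ _) = true
  isSpanned _             = false

  arc-sound : ∀ {j y a} (s : Status j y) → arc s ≡ just a → IncomingArc j y (proj₁ a) × proj₂ a ≡ y × y ∈ Y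
  arc-sound (entered v incoming y∈Y) refl = incoming , refl , y∈Y

  isSpanned-sound : ∀ {j y} (s : Status j y) → isSpanned s ≡ true → SpannedVia M (S c j) (I j) y
  isSpanned-sound (spanned sp _) refl = sp

  status-count : ∀ {j y} (s : Status j y) → 𝟙 (is-just (arc s)) + 𝟙 (isSpanned s) ≡ 𝟙 (lookup Y y)
  status-count (notInY y∉Y)      = cong 𝟙 (sym (x∉p⇒lookup≡outside y∉Y))
  status-count (entered _ _ y∈Y) = cong 𝟙 (sym ([]=⇒lookup y∈Y))
  status-count (spanned _ y∈Y)   = cong 𝟙 (sym ([]=⇒lookup y∈Y))

  arcInto : Fin K × Fin n → Maybe (Vertex K n × Fin n)
  arcInto (j , y) = arc (status j y)

  pairs : List (Fin K × Fin n)
  pairs = cartesianProduct (allFin K) (allFin n)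

  enteringArcs : List (Vertex K n × Fin n)
  enteringArcs = mapMaybe arcInto pairs

  Z : Fin K → Subset n
  Z j = tabulate (isSpanned ∘ status j)

  arcInto-determined : ∀ {k k′ a b} → arcInto k ≡ just a → arcInto k′ ≡ just b →
                       proj₂ a ≡ proj₂ b → colorV c (proj₁ a) ≡ colorV c (proj₁ b) → k ≡ k′
  arcInto-determined {j , y} {j′ , y′} eq eq′ same-target same-colour
    with arc-sound (status j y) eq | arc-sound (status j′ y′) eq′
  ... | (_ , colour , _) , target , _ | (_ , colour′ , _) , target′ , _ =
    cong₂ _,_ (Fin-suc-injective (trans (sym colour) (trans same-colour colour′)))
              (trans (sym target) (trans same-target target′))

  enteringArcs-unique : Unique enteringArcs
  enteringArcs-unique = mapMaybe⁺-Unique arcInto (λ eq eq′ → arcInto-determined eq eq′ refl refl)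
                                         (cartesianProduct⁺ (allFin⁺ K) (allFin⁺ n))

  enteringArcs-sound : ∀ {a} → a ∈ₗ enteringArcs →
                       Arc M c (proj₁ a) (inj₂ (proj₂ a)) × proj₂ a ∈ Y × (∀ x → proj₁ a ≡ inj₂ x → x ∉ Y)
  enteringArcs-sound a∈ with ∈-mapMaybe⁻ arcInto pairs a∈
  ... | (j , y) , _ , eq with arc-sound (status j y) eq
  ...   | (isArc , _ , fromOutsideY) , refl , y∈Y = isArc , y∈Y , fromOutsideY

  enteringArcs-separated : ∀ {a b} → a ∈ₗ enteringArcs → b ∈ₗ enteringArcs → proj₂ a ≡ proj₂ b →
                           colorV c (proj₁ a) ≡ colorV c (proj₁ b) → a ≡ b
  enteringArcs-separated a∈ b∈ same-target same-colour
    with ∈-mapMaybe⁻ arcInto pairs a∈ | ∈-mapMaybe⁻ arcInto pairs b∈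
  ... | k , _ , eq | k′ , _ , eq′ =
    just-injective (trans (sym eq) (trans (cong arcInto (arcInto-determined eq eq′ same-target same-colour)) eq′))

  arcCount : Fin K → ℕ
  arcCount j = ∑[ y < n ] 𝟙 (is-just (arcInto (j , y)))

  length-enteringArcs : length enteringArcs ≡ ∑[ j < K ] arcCount j
  length-enteringArcs = trans (length-mapMaybe-cartesianProduct arcInto id (allFin n))
                              (sum-cong-≗ (λ j → length-mapMaybe-tabulate (arcInto ∘ (j ,_)) id))

  arcCount+∣Z∣≡∣Y∣ : ∀ j → arcCount j + ∣ Z j ∣ ≡ ∣ Y ∣
  arcCount+∣Z∣≡∣Y∣ j = begin
    arcCount j + ∣ Z j ∣
      ≡⟨ cong (arcCount j +_) (∣tabulate∣≡∑𝟙 (isSpanned ∘ status j)) ⟩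
    arcCount j + ∑[ y < n ] 𝟙 (isSpanned (status j y))
      ≡⟨ sym (∑-distrib-+ _ (λ y → 𝟙 (isSpanned (status j y)))) ⟩
    ∑[ y < n ] (𝟙 (is-just (arc (status j y))) + 𝟙 (isSpanned (status j y)))
      ≡⟨ sum-cong-≗ (status-count ∘ status j) ⟩
    ∑[ y < n ] 𝟙 (lookup Y y)
      ≡⟨ sym (∣p∣≡∑𝟙 Y) ⟩
    ∣ Y ∣
      ∎
    where open ≡-Reasoning

  length-enteringArcs+∑∣Z∣ : length enteringArcs + ∑[ j < K ] ∣ Z j ∣ ≡ K * ∣ Y ∣
  length-enteringArcs+∑∣Z∣ = begin
    length enteringArcs + ∑[ j < K ] ∣ Z j ∣       ≡⟨ cong (_+ ∑[ j < K ] ∣ Z j ∣) length-enteringArcs ⟩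
    ∑[ j < K ] arcCount j + ∑[ j < K ] ∣ Z j ∣     ≡⟨ sym (∑-distrib-+ arcCount (λ j → ∣ Z j ∣)) ⟩
    ∑[ j < K ] (arcCount j + ∣ Z j ∣)              ≡⟨ sum-cong-≗ arcCount+∣Z∣≡∣Y∣ ⟩
    ∑[ j < K ] ∣ Y ∣                               ≡⟨ ∑-const K ∣ Y ∣ ⟩
    K * ∣ Y ∣                                      ∎
    where open ≡-Reasoning

  ∣Z∣≤α*∣I∣ : ∀ {α} (f : Fin n → Fin α) → (∀ k → Ind M (classOf f k)) → (∀ j → Ind M (S c j)) →
              ∀ j → ∣ Z j ∣ ≤ α * ∣ I j ∣
  ∣Z∣≤α*∣I∣ {α} f indf indS j = begin
    ∣ Z j ∣                           ≡⟨ ∣p∣≡∑∣p∩classOf∣ (Z j) f ⟩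
    ∑[ k < α ] ∣ Z j ∩ classOf f k ∣  ≤⟨ ∑-mono-≤ ∣Z∩classOf∣≤∣I∣ ⟩
    ∑[ k < α ] ∣ I j ∣                ≡⟨ ∑-const α ∣ I j ∣ ⟩
    α * ∣ I j ∣                       ∎
    where
    open ≤-Reasoning
    ∣Z∩classOf∣≤∣I∣ : ∀ k → ∣ Z j ∩ classOf f k ∣ ≤ ∣ I j ∣
    ∣Z∩classOf∣≤∣I∣ k = spanned⇒∣J∣≤∣I∣ M (indS j) (p∩q⊆q Y (S c j))
      (Ind-⊆ M (p∩q⊆q (Z j) (classOf f k)) (indf k))
      (λ {y} y∈ → isSpanned-sound (status j y) (∈tabulate⁻ (isSpanned ∘ status j) (proj₁ (x∈p∩q⁻ (Z j) _ y∈))))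

  ∑∣Z∣≤α*∑∣I∣ : ∀ {α} (f : Fin n → Fin α) → (∀ k → Ind M (classOf f k)) → (∀ j → Ind M (S c j)) →
                ∑[ j < K ] ∣ Z j ∣ ≤ α * ∑[ j < K ] ∣ I j ∣
  ∑∣Z∣≤α*∑∣I∣ {α} f indf indS =
    ≤-trans (∑-mono-≤ (∣Z∣≤α*∣I∣ f indf indS)) (≤-reflexive (sym (*-distribˡ-sum α (λ j → ∣ I j ∣))))

  ∑∣I∣<∣Y∣ : ∀ {u} → u ∈ Y → c u ≡ zero → ∑[ j < K ] ∣ I j ∣ < ∣ Y ∣
  -- Splitting Y along all classes of c, the uncoloured class (colour zero) is the first summand
  -- and contains u; the class of suc j is S c j by definition.
  ∑∣I∣<∣Y∣ u∈Y cu≡0 = subst (∑[ j < K ] ∣ I j ∣ <_) (sym (∣p∣≡∑∣p∩classOf∣ Y c))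
    (m<n+m (∑[ j < K ] ∣ I j ∣) (x∈p⇒0<∣p∣ (x∈p∩q⁺ (u∈Y , ∈classOf⁺ cu≡0))))

L+Z≡[a+b]*y⇒b*y<L : ∀ {a b y L Z W} → L + Z ≡ (a + b) * y → Z ≤ a * W → W < y → 0 < a → b * y < L
L+Z≡[a+b]*y⇒b*y<L {a} {b} {y} {L} {Z} {W} L+Z≡ Z≤aW W<y 0<a =
  <-≤-trans (m<m+n (b * y) 0<a) (+-cancelʳ-≤ (a * W) (b * y + a) L by+a+aW≤L+aW)
  where
  open ≤-Reasoning
  by+a+aW≤L+aW : b * y + a + a * W ≤ L + a * W
  by+a+aW≤L+aW = begin
    b * y + a + a * W    ≡⟨ +-assoc (b * y) a (a * W) ⟩
    b * y + (a + a * W)  ≡⟨ cong (b * y +_) (sym (*-suc a W)) ⟩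
    b * y + a * suc W    ≤⟨ +-monoʳ-≤ (b * y) (*-monoʳ-≤ a W<y) ⟩
    b * y + a * y        ≡⟨ +-comm (b * y) (a * y) ⟩
    a * y + b * y        ≡⟨ sym (*-distribʳ-+ y a b) ⟩
    (a + b) * y          ≡⟨ sym L+Z≡ ⟩
    L + Z                ≤⟨ +-monoʳ-≤ L Z≤aW ⟩
    L + a * W            ∎

lemma4p4 : ∀ {n r : ℕ} (M₁ : Matroid n) (p : Fin r → Fin n → ℕ)
    (α : ℕ) (χ : Fin r → ℕ) →
    IsChromaticNumber (Ind M₁) α →
    (∀ i → IsChromaticNumber (PartInd (p i)) (χ i)) →
    let B = ∑ (λ i → χ i ∸ 1) in
    (c : Fin n → Fin (ℕ.suc (α + B))) →
    (∀ j → Ind M₁ (S c j)) →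
    (∀ i j → PartInd (p i) (S c j)) →
    (∃ λ u → c u ≡ zero) →
    (Y : Subset n) →
    (∀ x → c x ≡ zero → x ∈ Y) →
    Σ (List (Vertex (α + B) n × Fin n)) λ A′ →
      Unique A′ ×
      (∀ {a} → a ∈ₗ A′ →
        Arc M₁ c (proj₁ a) (inj₂ (proj₂ a)) ×
        proj₂ a ∈ Y ×
        (∀ x → proj₁ a ≡ inj₂ x → x ∉ Y)) ×
      (∀ {a b} → a ∈ₗ A′ → b ∈ₗ A′ → proj₂ a ≡ proj₂ b →
        colorV c (proj₁ a) ≡ colorV c (proj₁ b) → a ≡ b) ×
      B * ∣ Y ∣ < length A′
-- Of the partition matroids only the value of B matters.
lemma4p4 M₁ _ α _ ((f , indf) , _) _ c indS _ (u , cu≡0) Y uncoloured∈Y =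
  enteringArcs , enteringArcs-unique , enteringArcs-sound , enteringArcs-separated ,
  L+Z≡[a+b]*y⇒b*y<L length-enteringArcs+∑∣Z∣ (∑∣Z∣≤α*∑∣I∣ f indf indS)
                    (∑∣I∣<∣Y∣ (uncoloured∈Y u cu≡0) cu≡0) 0<α
  where
  open EdmondsArcs M₁ c Y
  0<α : 0 < α
  0<α = >-nonZero⁻¹ α {{nonZeroIndex (f u)}}
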